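{- Assume the setting described in the context. For every $v\in\{0,\dots,\tau-1\}$ and every integer $u\ge0$, $j_{v+u,u}=k_{v,u}$.
   Context: Setting. Let $m,l\ge 2$ be coprime integers and $\tau\ge1$ an integer. Let $f_0,\dots,f_{\tau-1}$ be positive integers. Let $(a_{v,i})$, $v\in\{0,\dots,\tau-1\}$, $i\in\{0,\dots,l-1\}$, be integers with $a_{v,0}=0$ and, for $i\neq0$: $a_{v,i}\equiv -m^{f_v}i \pmod l$, $a_{v,i}\not\equiv0\pmod m$ and $a_{v,i}\not\equiv 0\pmod l$. For each $v\in\{0,\dots,\tau-1\}$ fix an admissible choice: an index $i_v\in\{1,\dots,l-1\}$, with $a_v:=a_{v,i_v}$; an integer $s_v$ with $1\le s_v\le m^{f_v}-1$ and $\gcd(s_v,m)=1$; and positive integers $e_v,r_v$ with $r_v\equiv i_v\pmod l$, $l^{e_v}s_v=m^{f_v}r_v+a_v$, and $|a_v|<\max(m^{f_v},l^{e_v})$. All indexed quantities are extended $\tau$-periodically to all integer indices. Iterates. Let $\mathbb Z_{\langle m,l\rangle}$ be the subring of $\mathbb Q$ of fractions whose denominators are coprime to both $m$ and $l$. Let $(n_v)_{v\in\mathbb Z}$ be a $\tau$-periodic sequence in $\mathbb Z_{\langle m,l\rangle}$ with $n_v\equiv s_v\pmod{m^{f_v}}$ and $n_{v+1}=l^{e_v}\frac{n_v-s_v}{m^{f_v}}+r_v$ for all $v$. Graded quotients. $k_{v,0}=n_v$, $k_{v,u}=m^{f_{v+u}}k_{v,u+1}+d_{v,u}$ with $d_{v,u}\in\{0,\dots,m^{f_{v+u}}-1\}$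 and $k_{v,u+1}\in\mathbb Z_{\langle m,l\rangle}$ (the $u$-th $\mathbf m$-adic quotient of $n_v$); $j_{v,0}=n_v$, $j_{v,u}=l^{e_{v-1-u}}j_{v,u+1}+b_{v,u}$ with $b_{v,u}\in\{0,\dots,l^{e_{v-1-u}}-1\}$ and $j_{v,u+1}\in\mathbb Z_{\langle m,l\rangle}$ (the $u$-th $\mathbf l$-adic quotient of $n_v$). Indices of $j$ are taken modulo $\tau$ in the first subscript ($j_{v+\tau,u}=j_{v,u}$). -}

module Defs where

open import Data.Nat as ℕ using (ℕ; suc; _<_; _≤_; _⊔_; _^_)
open import Data.Nat.Coprimality using (Coprime)
open import Data.Integer as ℤ using (ℤ; +_)
import Data.Integer.Divisibility as ℤD
open import Data.Rational as ℚ using (ℚ; ↧ₙ_)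
open import Data.Product using (Σ; _×_)
open import Relation.Binary.PropositionalEquality using (_≡_)

infix 4 _≡_[mod_]
_≡_[mod_] : ℤ → ℤ → ℕ → Set
x ≡ y [mod n ] = (+ n) ℤD.∣ (x ℤ.- y)

ℤ→ℚ : ℤ → ℚ
ℤ→ℚ x = x ℚ./ 1

ℕ→ℚ : ℕ → ℚ
ℕ→ℚ n = ℤ→ℚ (+ n)

InZ⟨_,_⟩ : ℕ → ℕ → ℚ → Set
InZ⟨ m , l ⟩ q = Coprime (↧ₙ q) m × Coprime (↧ₙ q) l

Cong⟨_,_⟩ : ℕ → ℕ → ℚ → ℚ → ℕ → Set
Cong⟨ m , l ⟩ x y M = Σ ℚ λ t → InZ⟨ m , l ⟩ t × (x ℚ.- y ≡ ℕ→ℚ M ℚ.* t)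

Periodic : {A : Set} → ℕ → (ℤ → A) → Set
Periodic {A} τ g = (v : ℤ) → g (v ℤ.+ + τ) ≡ g v

module Submission where

-- Write M_w = m^{f_w} and L_w = l^{e_w}.  The congruence n_w ≡ s_w (mod M_w)
-- makes s_w the first M_w-adic digit of n_w, so the iteration reads
--   n_{w+1} = L_w · k_{w,1} + r_w   with r_w < L_w            (⋆)
-- (the bound r_w < L_w is an elementary consequence of the admissibility
-- conditions on a_w, s_w, e_w, r_w).  A relation of the shape A = L·B + c,
-- c < L, is inherited by the m-adic quotients of A and B (carry lemma), so
-- (⋆) propagates to k_{w+1,u} = L_w · k_{w,u+1} + c with c < L_w for all u.
-- Induction on u, using uniqueness of l-adic division in ℤ_{⟨m,l⟩}, then
-- gives j_{w+u,u} = k_{w,u} for every w ∈ ℤ.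

open import Defs
open import Data.Nat as ℕ using (ℕ; suc; _<_; _≤_; _⊔_; _^_; _*_)
open import Data.Nat.Coprimality using (Coprime)
open import Data.Integer as ℤ using (ℤ; +_)
open import Data.Rational as ℚ using (ℚ)
open import Data.Product using (_×_)
open import Relation.Nullary using (¬_)
open import Relation.Binary.PropositionalEquality using (_≡_)

open import Data.Nat using (zero)
import Data.Nat.Properties as ℕP
import Data.Nat.Divisibility as ℕD
import Data.Nat.Coprimality as Coprimality
open import Data.Nat.GCD using (module Bézout)
open import Data.Integer using (-[1+_])
import Data.Integer.Properties as ℤP
import Data.Rational.Properties as ℚP
import Data.Rational.Unnormalised as U
import Data.Rational.Unnormalised.Properties as UP
open import Data.Product using (Σ; _,_; proj₁; proj₂)
open import Data.Empty using (⊥; ⊥-elim)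
open import Relation.Nullary using (yes; no)
open import Relation.Binary.PropositionalEquality
  using (refl; sym; trans; cong; cong₂; subst; module ≡-Reasoning)
open import Data.Integer.Tactic.RingSolver using () renaming (solve-∀ to ℤ-solve)
open import Data.Nat.Tactic.RingSolver using () renaming (solve-∀ to ℕ-solve)
open import Data.Rational.Solver using (module +-*-Solver)
open +-*-Solver using (solve; _:=_; _:+_; _:*_; _:-_; con)

ι : ℤ → ℚ
ι = ℤ→ℚ

ι-toℚᵘ : ∀ z → ℚ.toℚᵘ (ι z) U.≃ U.mkℚᵘ z 0
ι-toℚᵘ z = ℚP.toℚᵘ-fromℚᵘ (U.mkℚᵘ z 0)

ι-+ : ∀ a b → ι (a ℤ.+ b) ≡ ι a ℚ.+ ι b
ι-+ a b = ℚP.toℚᵘ-injective (begin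
  ℚ.toℚᵘ (ι (a ℤ.+ b))                 ≈⟨ ι-toℚᵘ (a ℤ.+ b) ⟩
  U.mkℚᵘ (a ℤ.+ b) 0                   ≈⟨ U.*≡* (sum-identity a b) ⟩
  U.mkℚᵘ a 0 U.+ U.mkℚᵘ b 0            ≈⟨ UP.+-cong (ι-toℚᵘ a) (ι-toℚᵘ b) ⟨
  ℚ.toℚᵘ (ι a) U.+ ℚ.toℚᵘ (ι b)        ≈⟨ ℚP.toℚᵘ-homo-+ (ι a) (ι b) ⟨
  ℚ.toℚᵘ (ι a ℚ.+ ι b)                 ∎)
  where
  open UP.≃-Reasoning
  sum-identity : ∀ a b → (a ℤ.+ b) ℤ.* (+ 1 ℤ.* + 1) ≡ (a ℤ.* + 1 ℤ.+ b ℤ.* + 1) ℤ.* + 1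
  sum-identity = ℤ-solve

ι-* : ∀ a b → ι (a ℤ.* b) ≡ ι a ℚ.* ι b
ι-* a b = ℚP.toℚᵘ-injective (begin
  ℚ.toℚᵘ (ι (a ℤ.* b))                 ≈⟨ ι-toℚᵘ (a ℤ.* b) ⟩
  U.mkℚᵘ (a ℤ.* b) 0                   ≈⟨ U.*≡* (product-identity a b) ⟩
  U.mkℚᵘ a 0 U.* U.mkℚᵘ b 0            ≈⟨ UP.*-cong (ι-toℚᵘ a) (ι-toℚᵘ b) ⟨
  ℚ.toℚᵘ (ι a) U.* ℚ.toℚᵘ (ι b)        ≈⟨ ℚP.toℚᵘ-homo-* (ι a) (ι b) ⟨
  ℚ.toℚᵘ (ι a ℚ.* ι b)                 ∎)
  where
  open UP.≃-Reasoning
  product-identity : ∀ a b → (a ℤ.* b) ℤ.* (+ 1 ℤ.* + 1) ≡ (a ℤ.* b) ℤ.* + 1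
  product-identity = ℤ-solve

ι-neg : ∀ a → ι (ℤ.- a) ≡ ℚ.- ι a
ι-neg a = ℚP.toℚᵘ-injective (begin
  ℚ.toℚᵘ (ι (ℤ.- a))                   ≈⟨ ι-toℚᵘ (ℤ.- a) ⟩
  U.- U.mkℚᵘ a 0                       ≈⟨ UP.-‿cong (ι-toℚᵘ a) ⟨
  U.- ℚ.toℚᵘ (ι a)                     ≈⟨ ℚP.toℚᵘ-homo‿- (ι a) ⟨
  ℚ.toℚᵘ (ℚ.- ι a)                     ∎)
  where open UP.≃-Reasoning

ι-- : ∀ a b → ι (a ℤ.- b) ≡ ι a ℚ.- ι b
ι-- a b = trans (ι-+ a (ℤ.- b)) (cong (ι a ℚ.+_) (ι-neg b))

ι-injective : ∀ {a b} → ι a ≡ ι b → a ≡ b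
ι-injective {a} {b} ιa≡ιb
  with UP.≃-trans (UP.≃-sym (ι-toℚᵘ a)) (UP.≃-trans (ℚP.toℚᵘ-cong ιa≡ιb) (ι-toℚᵘ b))
... | U.*≡* a*1≡b*1 = trans (sym (ℤP.*-identityʳ a)) (trans a*1≡b*1 (ℤP.*-identityʳ b))

ℕ→ℚ-+ : ∀ a b → ℕ→ℚ (a ℕ.+ b) ≡ ℕ→ℚ a ℚ.+ ℕ→ℚ b
ℕ→ℚ-+ a b = trans (cong ι (ℤP.pos-+ a b)) (ι-+ (+ a) (+ b))

ℕ→ℚ-* : ∀ a b → ℕ→ℚ (a * b) ≡ ℕ→ℚ a ℚ.* ℕ→ℚ b
ℕ→ℚ-* a b = trans (cong ι (ℤP.pos-* a b)) (ι-* (+ a) (+ b))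

ℕ→ℚ-*-cancelˡ : ∀ {M x y} → 1 ≤ M → ℕ→ℚ M ℚ.* x ≡ ℕ→ℚ M ℚ.* y → x ≡ y
ℕ→ℚ-*-cancelˡ {suc M} {x} {y} _ Mx≡My = begin
  x                          ≡⟨ ℚP.*-identityˡ x ⟨
  ℚ.1ℚ ℚ.* x                 ≡⟨ cong (ℚ._* x) (ℚP.*-inverseˡ c) ⟨
  (ℚ.1/ c ℚ.* c) ℚ.* x       ≡⟨ ℚP.*-assoc (ℚ.1/ c) c x ⟩
  ℚ.1/ c ℚ.* (c ℚ.* x)       ≡⟨ cong (ℚ.1/ c ℚ.*_) Mx≡My ⟩
  ℚ.1/ c ℚ.* (c ℚ.* y)       ≡⟨ ℚP.*-assoc (ℚ.1/ c) c y ⟨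
  (ℚ.1/ c ℚ.* c) ℚ.* y       ≡⟨ cong (ℚ._* y) (ℚP.*-inverseˡ c) ⟩
  ℚ.1ℚ ℚ.* y                 ≡⟨ ℚP.*-identityˡ y ⟩
  y                          ∎
  where
  open ≡-Reasoning
  c : ℚ
  c = ℕ→ℚ (suc M)
  instance
    c≢0 : ℚ.NonZero c
    c≢0 = ℚ.≢-nonZero λ c≡0 → ℕP.1+n≢0 (ℤP.+-injective (ι-injective {+ suc M} {+ 0} c≡0))

IsInt : ℚ → Set
IsInt q = Σ ℤ λ z → q ≡ ι z

int-ℕ : ∀ n → IsInt (ℕ→ℚ n)
int-ℕ n = + n , refl

int-* : ∀ {x y} → IsInt x → IsInt y → IsInt (x ℚ.* y)
int-* (a , refl) (b , refl) = a ℤ.* b , sym (ι-* a b)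

int-- : ∀ {x y} → IsInt x → IsInt y → IsInt (x ℚ.- y)
int-- (a , refl) (b , refl) = a ℤ.- b , sym (ι-- a b)

-- Rationals with denominator prime to m and l.

coprime-* : ∀ {a b m} → Coprime a m → Coprime b m → Coprime (a * b) m
coprime-* {a} {b} {m} a⊥m b⊥m {i} (i∣ab , i∣m) = b⊥m (Coprimality.coprime-divisor i⊥a i∣ab , i∣m)
  where
  i⊥a : Coprime i a
  i⊥a (j∣i , j∣a) = a⊥m (j∣a , ℕD.∣-trans j∣i i∣m)

coprime-^ : ∀ {D m} → Coprime D m → ∀ F → Coprime D (m ^ F)
coprime-^ _   zero    (_ , i∣1) = ℕD.∣1⇒≡1 i∣1
coprime-^ D⊥m (suc F) = Coprimality.sym (coprime-* (Coprimality.sym D⊥m) (Coprimality.sym (coprime-^ D⊥m F)))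

-- q·D is an integer for some D coprime to m and l; this is what membership
-- in ℤ_{⟨m,l⟩} means, in a form closed under ring operations.
PrimeDenom⟨_,_⟩ : ℕ → ℕ → ℚ → Set
PrimeDenom⟨ m , l ⟩ q = Σ ℕ λ D → Coprime D m × Coprime D l × IsInt (ℕ→ℚ D ℚ.* q)

PrimeToDenoms⟨_,_⟩ : ℕ → ℕ → ℕ → Set
PrimeToDenoms⟨ m , l ⟩ M = ∀ {D} → Coprime D m → Coprime D l → Coprime D M

powers-of-m : ∀ {m l} F → PrimeToDenoms⟨ m , l ⟩ (m ^ F)
powers-of-m F D⊥m _ = coprime-^ D⊥m F

powers-of-l : ∀ {m l} F → PrimeToDenoms⟨ m , l ⟩ (l ^ F)
powers-of-l F _ D⊥l = coprime-^ D⊥l F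

denominator-clears : ∀ q → ℕ→ℚ (ℚ.↧ₙ q) ℚ.* q ≡ ι (ℚ.↥ q)
denominator-clears q@(ℚ.mkℚ n d-1 _) = ℚP.toℚᵘ-injective (begin
  ℚ.toℚᵘ (ℕ→ℚ D ℚ.* q)                  ≈⟨ ℚP.toℚᵘ-homo-* (ℕ→ℚ D) q ⟩
  ℚ.toℚᵘ (ℕ→ℚ D) U.* U.mkℚᵘ n d-1       ≈⟨ UP.*-congʳ (ι-toℚᵘ (+ D)) ⟩
  U.mkℚᵘ (+ D) 0 U.* U.mkℚᵘ n d-1       ≈⟨ U.*≡* (cleared (+ D) n) ⟩
  U.mkℚᵘ n 0                            ≈⟨ ι-toℚᵘ n ⟨
  ℚ.toℚᵘ (ι n)                          ∎)
  where
  open UP.≃-Reasoning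
  D : ℕ
  D = suc d-1
  cleared : ∀ D n → (D ℤ.* n) ℤ.* + 1 ≡ n ℤ.* (D ℤ.+ + 0)
  cleared = ℤ-solve

inZ⇒primeDenom : ∀ {m l q} → InZ⟨ m , l ⟩ q → PrimeDenom⟨ m , l ⟩ q
inZ⇒primeDenom {q = q} (↧q⊥m , ↧q⊥l) = ℚ.↧ₙ q , ↧q⊥m , ↧q⊥l , (ℚ.↥ q , denominator-clears q)

primeDenom-- : ∀ {m l x y} → PrimeDenom⟨ m , l ⟩ x → PrimeDenom⟨ m , l ⟩ y → PrimeDenom⟨ m , l ⟩ (x ℚ.- y)
primeDenom-- {x = x} {y} (D₁ , D₁⊥m , D₁⊥l , D₁x) (D₂ , D₂⊥m , D₂⊥l , D₂y) =
  D₁ * D₂ , coprime-* D₁⊥m D₂⊥m , coprime-* D₁⊥l D₂⊥l ,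
  subst IsInt (sym common-denominator) (int-- (int-* (int-ℕ D₂) D₁x) (int-* (int-ℕ D₁) D₂y))
  where
  open ≡-Reasoning
  rearrange : ∀ a b x y → (a ℚ.* b) ℚ.* (x ℚ.- y) ≡ b ℚ.* (a ℚ.* x) ℚ.- a ℚ.* (b ℚ.* y)
  rearrange = solve 4 (λ a b x y → (a :* b) :* (x :- y) := b :* (a :* x) :- a :* (b :* y)) refl
  common-denominator : ℕ→ℚ (D₁ * D₂) ℚ.* (x ℚ.- y) ≡ ℕ→ℚ D₂ ℚ.* (ℕ→ℚ D₁ ℚ.* x) ℚ.- ℕ→ℚ D₁ ℚ.* (ℕ→ℚ D₂ ℚ.* y)
  common-denominator = begin
    ℕ→ℚ (D₁ * D₂) ℚ.* (x ℚ.- y)                           ≡⟨ cong (ℚ._* (x ℚ.- y)) (ℕ→ℚ-* D₁ D₂) ⟩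
    (ℕ→ℚ D₁ ℚ.* ℕ→ℚ D₂) ℚ.* (x ℚ.- y)                     ≡⟨ rearrange (ℕ→ℚ D₁) (ℕ→ℚ D₂) x y ⟩
    ℕ→ℚ D₂ ℚ.* (ℕ→ℚ D₁ ℚ.* x) ℚ.- ℕ→ℚ D₁ ℚ.* (ℕ→ℚ D₂ ℚ.* y) ∎

primeDenom-scale : ∀ {m l y} L → PrimeDenom⟨ m , l ⟩ y → PrimeDenom⟨ m , l ⟩ (ℕ→ℚ L ℚ.* y)
primeDenom-scale {y = y} L (D , D⊥m , D⊥l , Dy) =
  D , D⊥m , D⊥l , subst IsInt (commute (ℕ→ℚ L) (ℕ→ℚ D) y) (int-* (int-ℕ L) Dy)
  where
  commute : ∀ a b y → a ℚ.* (b ℚ.* y) ≡ b ℚ.* (a ℚ.* y)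
  commute = solve 3 (λ a b y → a :* (b :* y) := b :* (a :* y)) refl

bézout-integral : ∀ {A B x y q} → 1 ℕ.+ y * B ≡ x * A →
                  IsInt (ℕ→ℚ A ℚ.* q) → IsInt (ℕ→ℚ B ℚ.* q) → IsInt q
bézout-integral {A} {B} {x} {y} {q} bézout Aq Bq =
  subst IsInt (sym q≡combination) (int-- (int-* (int-ℕ x) Aq) (int-* (int-ℕ y) Bq))
  where
  open ≡-Reasoning
  split : ∀ q X A Y B → (X ℚ.* A) ℚ.* q ℚ.- (Y ℚ.* B) ℚ.* q ≡ X ℚ.* (A ℚ.* q) ℚ.- Y ℚ.* (B ℚ.* q)
  split = solve 5 (λ q X A Y B → (X :* A) :* q :- (Y :* B) :* q := X :* (A :* q) :- Y :* (B :* q)) refl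
  unit : ∀ q YB → q ≡ (ℚ.1ℚ ℚ.+ YB) ℚ.* q ℚ.- YB ℚ.* q
  unit = solve 2 (λ q YB → q := (con ℚ.1ℚ :+ YB) :* q :- YB :* q) refl
  q≡combination : q ≡ ℕ→ℚ x ℚ.* (ℕ→ℚ A ℚ.* q) ℚ.- ℕ→ℚ y ℚ.* (ℕ→ℚ B ℚ.* q)
  q≡combination = begin
    q                                                      ≡⟨ unit q (ℕ→ℚ (y * B)) ⟩
    (ℚ.1ℚ ℚ.+ ℕ→ℚ (y * B)) ℚ.* q ℚ.- ℕ→ℚ (y * B) ℚ.* q     ≡⟨ cong (λ t → t ℚ.* q ℚ.- ℕ→ℚ (y * B) ℚ.* q) (ℕ→ℚ-+ 1 (y * B)) ⟨
    ℕ→ℚ (1 ℕ.+ y * B) ℚ.* q ℚ.- ℕ→ℚ (y * B) ℚ.* q          ≡⟨ cong (λ t → ℕ→ℚ t ℚ.* q ℚ.- ℕ→ℚ (y * B) ℚ.* q) bézout ⟩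
    ℕ→ℚ (x * A) ℚ.* q ℚ.- ℕ→ℚ (y * B) ℚ.* q                ≡⟨ cong₂ (λ s t → s ℚ.* q ℚ.- t ℚ.* q) (ℕ→ℚ-* x A) (ℕ→ℚ-* y B) ⟩
    (ℕ→ℚ x ℚ.* ℕ→ℚ A) ℚ.* q ℚ.- (ℕ→ℚ y ℚ.* ℕ→ℚ B) ℚ.* q    ≡⟨ split q (ℕ→ℚ x) (ℕ→ℚ A) (ℕ→ℚ y) (ℕ→ℚ B) ⟩
    ℕ→ℚ x ℚ.* (ℕ→ℚ A ℚ.* q) ℚ.- ℕ→ℚ y ℚ.* (ℕ→ℚ B ℚ.* q)    ∎

integrality : ∀ {m l M q c} → PrimeToDenoms⟨ m , l ⟩ M → PrimeDenom⟨ m , l ⟩ q →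
              ℕ→ℚ M ℚ.* q ≡ ι c → Σ ℤ λ z → q ≡ ι z × + M ℤ.* z ≡ c
integrality {M = M} {q} {c} M-ok (D , D⊥m , D⊥l , Dq) Mq≡c = z , q≡z , ι-injective Mz≡c
  where
  q-int : IsInt q
  q-int with Coprimality.coprime-Bézout (M-ok D⊥m D⊥l)
  ... | Bézout.+- x y bézout = bézout-integral {D} {M} {x} {y} bézout Dq (c , Mq≡c)
  ... | Bézout.-+ x y bézout = bézout-integral {M} {D} {y} {x} bézout (c , Mq≡c) Dq
  z : ℤ
  z = proj₁ q-int
  q≡z : q ≡ ι z
  q≡z = proj₂ q-int
  Mz≡c : ι (+ M ℤ.* z) ≡ ι c
  Mz≡c = trans (ι-* (+ M) z) (trans (cong (ℕ→ℚ M ℚ.*_) (sym q≡z)) Mq≡c)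

-- Division with remainder in ℤ_{⟨m,l⟩}.

nonnegative-quotient : ∀ {M N d} (z : ℤ) → d < M → + M ℤ.* z ≡ + N ℤ.- + d →
                       Σ ℕ λ c → z ≡ + c × M * c ℕ.+ d ≡ N
nonnegative-quotient {M} {N} {d} (+ c) _ Mc≡N-d = c , refl , ℤP.+-injective (begin
  + (M * c ℕ.+ d)             ≡⟨ ℤP.pos-+ (M * c) d ⟩
  + (M * c) ℤ.+ + d           ≡⟨ cong (ℤ._+ + d) (trans (ℤP.pos-* M c) Mc≡N-d) ⟩
  (+ N ℤ.- + d) ℤ.+ + d       ≡⟨ cancel (+ N) (+ d) ⟩
  + N                         ∎)
  where
  open ≡-Reasoning
  cancel : ∀ N d → (N ℤ.- d) ℤ.+ d ≡ N
  cancel = ℤ-solve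
nonnegative-quotient {M} {N} {d} -[1+ c ] d<M M[-1-c]≡N-d =
  ⊥-elim (ℕP.<-irrefl refl (ℕP.<-≤-trans d<M M≤d))
  where
  open ≡-Reasoning
  d≡N+M[1+c] : N ℕ.+ M * suc c ≡ d
  d≡N+M[1+c] = ℤP.+-injective (begin
    + (N ℕ.+ M * suc c)                 ≡⟨ trans (ℤP.pos-+ N (M * suc c)) (cong (ℤ._+_ (+ N)) (ℤP.pos-* M (suc c))) ⟩
    + N ℤ.+ + M ℤ.* + suc c             ≡⟨ shift (+ N) (+ d) (+ M) (+ suc c) ⟩
    + d ℤ.+ ((+ N ℤ.- + d) ℤ.- + M ℤ.* (ℤ.- + suc c))
                                        ≡⟨ cong (λ t → + d ℤ.+ ((+ N ℤ.- + d) ℤ.- t)) M[-1-c]≡N-d ⟩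
    + d ℤ.+ ((+ N ℤ.- + d) ℤ.- (+ N ℤ.- + d))
                                        ≡⟨ cancel (+ d) (+ N ℤ.- + d) ⟩
    + d                                 ∎)
    where
    shift : ∀ N d M x → N ℤ.+ M ℤ.* x ≡ d ℤ.+ ((N ℤ.- d) ℤ.- M ℤ.* (ℤ.- x))
    shift = ℤ-solve
    cancel : ∀ d t → d ℤ.+ (t ℤ.- t) ≡ d
    cancel = ℤ-solve
  M≤d : M ≤ d
  M≤d = subst (M ≤_) d≡N+M[1+c] (ℕP.≤-trans (ℕP.m≤m*n M (suc c)) (ℕP.m≤n+m (M * suc c) N))

integral-difference : ∀ {m l M N d X Z} → PrimeToDenoms⟨ m , l ⟩ M →
                      PrimeDenom⟨ m , l ⟩ X → PrimeDenom⟨ m , l ⟩ Z → d < M →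
                      ℕ→ℚ M ℚ.* (X ℚ.- Z) ≡ ι (+ N ℤ.- + d) →
                      Σ ℕ λ c → X ≡ Z ℚ.+ ℕ→ℚ c × M * c ℕ.+ d ≡ N
integral-difference {M = M} {N} {d} {X} {Z} M-ok pX pZ d<M M[X-Z]≡N-d =
  conclude (integrality {c = + N ℤ.- + d} M-ok (primeDenom-- pX pZ) M[X-Z]≡N-d)
  where
  regroup : ∀ x y → x ≡ y ℚ.+ (x ℚ.- y)
  regroup = solve 2 (λ x y → x := y :+ (x :- y)) refl
  conclude : (Σ ℤ λ z → X ℚ.- Z ≡ ι z × + M ℤ.* z ≡ + N ℤ.- + d) →
             Σ ℕ λ c → X ≡ Z ℚ.+ ℕ→ℚ c × M * c ℕ.+ d ≡ N
  conclude (z , X-Z≡z , Mz≡N-d) with nonnegative-quotient z d<M Mz≡N-d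
  ... | c , refl , Mc+d≡N = c , trans (regroup X Z) (cong (Z ℚ.+_) X-Z≡z) , Mc+d≡N

digit-unique : ∀ {m l M x y d d'} → PrimeToDenoms⟨ m , l ⟩ M →
               PrimeDenom⟨ m , l ⟩ x → PrimeDenom⟨ m , l ⟩ y → d < M → d' < M →
               ℕ→ℚ M ℚ.* x ℚ.+ ℕ→ℚ d ≡ ℕ→ℚ M ℚ.* y ℚ.+ ℕ→ℚ d' → x ≡ y × d ≡ d'
digit-unique {M = M} {x} {y} {d} {d'} M-ok px py d<M d'<M Mx+d≡My+d' =
  conclude (integral-difference M-ok px py d<M M[x-y]≡d'-d)
  where
  open ≡-Reasoning
  expand : ∀ M x y d d' → M ℚ.* (x ℚ.- y) ≡ ((M ℚ.* x ℚ.+ d) ℚ.- (M ℚ.* y ℚ.+ d')) ℚ.+ (d' ℚ.- d)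
  expand = solve 5 (λ M x y d d' → M :* (x :- y) := ((M :* x :+ d) :- (M :* y :+ d')) :+ (d' :- d)) refl
  cancel : ∀ a b → (a ℚ.- a) ℚ.+ b ≡ b
  cancel = solve 2 (λ a b → (a :- a) :+ b := b) refl
  M[x-y]≡d'-d : ℕ→ℚ M ℚ.* (x ℚ.- y) ≡ ι (+ d' ℤ.- + d)
  M[x-y]≡d'-d = begin
    ℕ→ℚ M ℚ.* (x ℚ.- y)
      ≡⟨ expand (ℕ→ℚ M) x y (ℕ→ℚ d) (ℕ→ℚ d') ⟩
    ((ℕ→ℚ M ℚ.* x ℚ.+ ℕ→ℚ d) ℚ.- (ℕ→ℚ M ℚ.* y ℚ.+ ℕ→ℚ d')) ℚ.+ (ℕ→ℚ d' ℚ.- ℕ→ℚ d)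
      ≡⟨ cong (λ t → (t ℚ.- (ℕ→ℚ M ℚ.* y ℚ.+ ℕ→ℚ d')) ℚ.+ (ℕ→ℚ d' ℚ.- ℕ→ℚ d)) Mx+d≡My+d' ⟩
    ((ℕ→ℚ M ℚ.* y ℚ.+ ℕ→ℚ d') ℚ.- (ℕ→ℚ M ℚ.* y ℚ.+ ℕ→ℚ d')) ℚ.+ (ℕ→ℚ d' ℚ.- ℕ→ℚ d)
      ≡⟨ cancel (ℕ→ℚ M ℚ.* y ℚ.+ ℕ→ℚ d') (ℕ→ℚ d' ℚ.- ℕ→ℚ d) ⟩
    ℕ→ℚ d' ℚ.- ℕ→ℚ d
      ≡⟨ ι-- (+ d') (+ d) ⟨
    ι (+ d' ℤ.- + d) ∎
  -- the quotient of d' − d by M is 0, since d' < M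
  conclude : (Σ ℕ λ c → x ≡ y ℚ.+ ℕ→ℚ c × M * c ℕ.+ d ≡ d') → x ≡ y × d ≡ d'
  conclude (zero , x≡y+0 , M0+d≡d') =
    trans x≡y+0 (ℚP.+-identityʳ y) , trans (cong (ℕ._+ d) (sym (ℕP.*-zeroʳ M))) M0+d≡d'
  conclude (suc c , _ , M[1+c]+d≡d') = ⊥-elim (ℕP.<-irrefl refl (ℕP.<-≤-trans d'<M M≤d'))
    where
    M≤d' : M ≤ d'
    M≤d' = subst (M ≤_) M[1+c]+d≡d' (ℕP.≤-trans (ℕP.m≤m*n M (suc c)) (ℕP.m≤m+n (M * suc c) d))

carry-bound : ∀ {M L c' d₁ d₂ c} → M * c' ℕ.+ d₁ ≡ L * d₂ ℕ.+ c → c < L → d₂ < M → c' < L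
carry-bound {M} {L} {c'} {d₁} {d₂} {c} Mc'+d₁≡Ld₂+c c<L d₂<M = ℕP.*-cancelˡ-< M c' L (begin-strict
  M * c'             ≤⟨ ℕP.m≤m+n (M * c') d₁ ⟩
  M * c' ℕ.+ d₁      ≡⟨ Mc'+d₁≡Ld₂+c ⟩
  L * d₂ ℕ.+ c       <⟨ ℕP.+-monoʳ-< (L * d₂) c<L ⟩
  L * d₂ ℕ.+ L       ≡⟨ trans (ℕP.+-comm (L * d₂) L) (sym (ℕP.*-suc L d₂)) ⟩
  L * suc d₂         ≤⟨ ℕP.*-monoʳ-≤ L d₂<M ⟩
  L * M              ≡⟨ ℕP.*-comm L M ⟩
  M * L              ∎)
  where open ℕP.≤-Reasoning

carry-step : ∀ {m l M L A B X Y d₁ d₂ c} → PrimeToDenoms⟨ m , l ⟩ M →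
             PrimeDenom⟨ m , l ⟩ X → PrimeDenom⟨ m , l ⟩ Y → d₁ < M → d₂ < M → c < L →
             A ≡ ℕ→ℚ M ℚ.* X ℚ.+ ℕ→ℚ d₁ → B ≡ ℕ→ℚ M ℚ.* Y ℚ.+ ℕ→ℚ d₂ →
             A ≡ ℕ→ℚ L ℚ.* B ℚ.+ ℕ→ℚ c →
             Σ ℕ λ c' → c' < L × X ≡ ℕ→ℚ L ℚ.* Y ℚ.+ ℕ→ℚ c'
carry-step {M = M} {L} {A} {B} {X} {Y} {d₁} {d₂} {c} M-ok pX pY d₁<M d₂<M c<L A≡MX+d₁ B≡MY+d₂ A≡LB+c =
  conclude (integral-difference M-ok pX (primeDenom-scale L pY) d₁<M M[X-LY]≡Ld₂+c-d₁)
  where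
  open ≡-Reasoning
  isolate : ∀ M X LY d₁ → M ℚ.* (X ℚ.- LY) ≡ ((M ℚ.* X ℚ.+ d₁) ℚ.- d₁) ℚ.- M ℚ.* LY
  isolate = solve 4 (λ M X LY d₁ → M :* (X :- LY) := ((M :* X :+ d₁) :- d₁) :- M :* LY) refl
  collect : ∀ M Y L d₂ c d₁ → ((L ℚ.* (M ℚ.* Y ℚ.+ d₂) ℚ.+ c) ℚ.- d₁) ℚ.- M ℚ.* (L ℚ.* Y)
                              ≡ (L ℚ.* d₂ ℚ.+ c) ℚ.- d₁
  collect = solve 6 (λ M Y L d₂ c d₁ → ((L :* (M :* Y :+ d₂) :+ c) :- d₁) :- M :* (L :* Y) := (L :* d₂ :+ c) :- d₁) refl
  M[X-LY]≡Ld₂+c-d₁ : ℕ→ℚ M ℚ.* (X ℚ.- ℕ→ℚ L ℚ.* Y) ≡ ι (+ (L * d₂ ℕ.+ c) ℤ.- + d₁)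
  M[X-LY]≡Ld₂+c-d₁ = begin
    ℕ→ℚ M ℚ.* (X ℚ.- ℕ→ℚ L ℚ.* Y)
      ≡⟨ isolate (ℕ→ℚ M) X (ℕ→ℚ L ℚ.* Y) (ℕ→ℚ d₁) ⟩
    ((ℕ→ℚ M ℚ.* X ℚ.+ ℕ→ℚ d₁) ℚ.- ℕ→ℚ d₁) ℚ.- ℕ→ℚ M ℚ.* (ℕ→ℚ L ℚ.* Y)
      ≡⟨ cong (λ t → (t ℚ.- ℕ→ℚ d₁) ℚ.- ℕ→ℚ M ℚ.* (ℕ→ℚ L ℚ.* Y)) (trans (sym A≡MX+d₁) A≡LB+c) ⟩
    ((ℕ→ℚ L ℚ.* B ℚ.+ ℕ→ℚ c) ℚ.- ℕ→ℚ d₁) ℚ.- ℕ→ℚ M ℚ.* (ℕ→ℚ L ℚ.* Y)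
      ≡⟨ cong (λ t → ((ℕ→ℚ L ℚ.* t ℚ.+ ℕ→ℚ c) ℚ.- ℕ→ℚ d₁) ℚ.- ℕ→ℚ M ℚ.* (ℕ→ℚ L ℚ.* Y)) B≡MY+d₂ ⟩
    ((ℕ→ℚ L ℚ.* (ℕ→ℚ M ℚ.* Y ℚ.+ ℕ→ℚ d₂) ℚ.+ ℕ→ℚ c) ℚ.- ℕ→ℚ d₁) ℚ.- ℕ→ℚ M ℚ.* (ℕ→ℚ L ℚ.* Y)
      ≡⟨ collect (ℕ→ℚ M) Y (ℕ→ℚ L) (ℕ→ℚ d₂) (ℕ→ℚ c) (ℕ→ℚ d₁) ⟩
    (ℕ→ℚ L ℚ.* ℕ→ℚ d₂ ℚ.+ ℕ→ℚ c) ℚ.- ℕ→ℚ d₁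
      ≡⟨ cong (λ t → (t ℚ.+ ℕ→ℚ c) ℚ.- ℕ→ℚ d₁) (ℕ→ℚ-* L d₂) ⟨
    (ℕ→ℚ (L * d₂) ℚ.+ ℕ→ℚ c) ℚ.- ℕ→ℚ d₁
      ≡⟨ cong (ℚ._- ℕ→ℚ d₁) (ℕ→ℚ-+ (L * d₂) c) ⟨
    ℕ→ℚ (L * d₂ ℕ.+ c) ℚ.- ℕ→ℚ d₁
      ≡⟨ ι-- (+ (L * d₂ ℕ.+ c)) (+ d₁) ⟨
    ι (+ (L * d₂ ℕ.+ c) ℤ.- + d₁) ∎
  conclude : (Σ ℕ λ c' → X ≡ ℕ→ℚ L ℚ.* Y ℚ.+ ℕ→ℚ c' × M * c' ℕ.+ d₁ ≡ L * d₂ ℕ.+ c) →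
             Σ ℕ λ c' → c' < L × X ≡ ℕ→ℚ L ℚ.* Y ℚ.+ ℕ→ℚ c'
  conclude (c' , X≡LY+c' , Mc'+d₁≡Ld₂+c) = c' , carry-bound Mc'+d₁≡Ld₂+c c<L d₂<M , X≡LY+c'

-- The carry r_w of the iteration is an l-adic digit: r_w < l^{e_w}.

-- Otherwise r = L + t and M·(L + t) ≥ L·s + L forces
-- a ≤ −(L + M·t); this contradicts the bound on |a| if t > 0, and l ∤ a if
-- t = 0 (then a = L·s − M·L is divisible by l).
remainder-bound : ∀ {l L M s r} (a : ℤ) → 1 ≤ L → l ℕD.∣ L → s < M →
                  + (L * s) ≡ + (M * r) ℤ.+ a → ℤ.∣ a ∣ < M ⊔ L → ¬ (a ≡ + 0 [mod l ]) → r < L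
remainder-bound {l} {L} {M} {s} {r} a 1≤L l∣L s<M Ls≡Mr+a ∣a∣<M⊔L l∤a with r ℕP.<? L
... | yes r<L = r<L
... | no r≮L with ℕP.m≤n⇒∃[o]m+o≡n (ℕP.≮⇒≥ r≮L)
...   | t , refl = ⊥-elim (overshoot a Ls≡Mr+a ∣a∣<M⊔L l∤a)
  where
  Ls+L≤LM : L * s ℕ.+ L ≤ M * L
  Ls+L≤LM = begin
    L * s ℕ.+ L     ≡⟨ trans (ℕP.+-comm (L * s) L) (sym (ℕP.*-suc L s)) ⟩
    L * suc s       ≤⟨ ℕP.*-monoʳ-≤ L s<M ⟩
    L * M           ≡⟨ ℕP.*-comm L M ⟩
    M * L           ∎
    where open ℕP.≤-Reasoning
  overshoot : (a : ℤ) → + (L * s) ≡ + (M * (L ℕ.+ t)) ℤ.+ a → ℤ.∣ a ∣ < M ⊔ L →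
              ¬ (a ≡ + 0 [mod l ]) → ⊥
  overshoot (+ p) Ls≡Mr+p _ _ = ℕP.<-irrefl refl (begin-strict
    L * s                    <⟨ ℕP.m<m+n (L * s) 1≤L ⟩
    L * s ℕ.+ L              ≤⟨ Ls+L≤LM ⟩
    M * L                    ≤⟨ ℕP.*-monoʳ-≤ M (ℕP.m≤m+n L t) ⟩
    M * (L ℕ.+ t)            ≤⟨ ℕP.m≤m+n (M * (L ℕ.+ t)) p ⟩
    M * (L ℕ.+ t) ℕ.+ p      ≡⟨ ℤP.+-injective Ls≡Mr+p ⟨
    L * s                    ∎)
    where open ℕP.≤-Reasoning
  overshoot -[1+ p ] Ls≡Mr-1-p ∣a∣<M⊔L l∤a = excess t L+Mt≤1+p Ls+1+p≡Mr
    where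
    move : ∀ x y → (x ℤ.+ ℤ.- y) ℤ.+ y ≡ x
    move = ℤ-solve
    Ls+1+p≡Mr : L * s ℕ.+ suc p ≡ M * (L ℕ.+ t)
    Ls+1+p≡Mr = ℤP.+-injective (trans (cong (ℤ._+ + suc p) Ls≡Mr-1-p) (move (+ (M * (L ℕ.+ t))) (+ suc p)))
    expand : ∀ L s M t → L * s ℕ.+ (L ℕ.+ M * t) ≡ (L * s ℕ.+ L) ℕ.+ M * t
    expand = ℕ-solve
    distrib : ∀ L M t → M * L ℕ.+ M * t ≡ M * (L ℕ.+ t)
    distrib = ℕ-solve
    L+Mt≤1+p : L ℕ.+ M * t ≤ suc p
    L+Mt≤1+p = ℕP.+-cancelˡ-≤ (L * s) _ _ (begin
      L * s ℕ.+ (L ℕ.+ M * t)       ≡⟨ expand L s M t ⟩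
      (L * s ℕ.+ L) ℕ.+ M * t       ≤⟨ ℕP.+-monoˡ-≤ (M * t) Ls+L≤LM ⟩
      M * L ℕ.+ M * t               ≡⟨ distrib L M t ⟩
      M * (L ℕ.+ t)                 ≡⟨ Ls+1+p≡Mr ⟨
      L * s ℕ.+ suc p               ∎)
      where open ℕP.≤-Reasoning
    excess : ∀ t → L ℕ.+ M * t ≤ suc p → L * s ℕ.+ suc p ≡ M * (L ℕ.+ t) → ⊥
    excess (suc t) L+Mt≤1+p _ = ℕP.<-irrefl refl (ℕP.<-≤-trans ∣a∣<M⊔L (begin
      M ⊔ L                     ≤⟨ ℕP.m⊔n≤m+n M L ⟩
      M ℕ.+ L                   ≡⟨ ℕP.+-comm M L ⟩
      L ℕ.+ M                   ≤⟨ ℕP.+-monoʳ-≤ L (ℕP.m≤m*n M (suc t)) ⟩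
      L ℕ.+ M * suc t           ≤⟨ L+Mt≤1+p ⟩
      suc p                     ∎))
      where open ℕP.≤-Reasoning
    excess zero _ Ls+1+p≡M[L+0] = l∤a (ℕD.∣m+n∣m⇒∣n l∣Ls+1+p (ℕD.∣-trans l∣L (ℕD.m∣m*n s)))
      where
      l∣Ls+1+p : l ℕD.∣ L * s ℕ.+ suc p
      l∣Ls+1+p = subst (l ℕD.∣_) (sym (trans Ls+1+p≡M[L+0] (cong (M *_) (ℕP.+-identityʳ L))))
                       (ℕD.∣-trans l∣L (ℕD.n∣m*n M))

divides-power : ∀ {l E} → 1 ≤ E → l ℕD.∣ l ^ E
divides-power {l} {suc E} _ = ℕD.m∣m*n (l ^ E)

-- The iteration in terms of m-adic quotients.

first-digit : ∀ {m l M s x q d} → PrimeToDenoms⟨ m , l ⟩ M → s < M →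
              Cong⟨ m , l ⟩ x (ℕ→ℚ s) M → x ≡ ℕ→ℚ M ℚ.* q ℚ.+ ℕ→ℚ d → d < M → InZ⟨ m , l ⟩ q →
              x ℚ.- ℕ→ℚ s ≡ ℕ→ℚ M ℚ.* q
first-digit {M = M} {s} {x} {q} M-ok s<M (t , t∈Z , x-s≡Mt) x≡Mq+d d<M q∈Z =
  trans x-s≡Mt (cong (ℕ→ℚ M ℚ.*_) (sym q≡t))
  where
  regroup : ∀ x s → x ≡ (x ℚ.- s) ℚ.+ s
  regroup = solve 2 (λ x s → x := (x :- s) :+ s) refl
  q≡t : q ≡ t
  q≡t = proj₁ (digit-unique M-ok (inZ⇒primeDenom q∈Z) (inZ⇒primeDenom t∈Z) d<M s<M
          (trans (sym x≡Mq+d) (trans (regroup x (ℕ→ℚ s)) (cong (ℚ._+ ℕ→ℚ s) x-s≡Mt))))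

successor-expansion : ∀ {M L n n' s r q} → 1 ≤ M →
                      ℕ→ℚ M ℚ.* (n' ℚ.- ℕ→ℚ r) ≡ ℕ→ℚ L ℚ.* (n ℚ.- ℕ→ℚ s) →
                      n ℚ.- ℕ→ℚ s ≡ ℕ→ℚ M ℚ.* q → n' ≡ ℕ→ℚ L ℚ.* q ℚ.+ ℕ→ℚ r
successor-expansion {M} {L} {n} {n'} {s} {r} {q} 1≤M iteration n-s≡Mq = begin
  n'                                 ≡⟨ regroup n' (ℕ→ℚ r) ⟩
  (n' ℚ.- ℕ→ℚ r) ℚ.+ ℕ→ℚ r           ≡⟨ cong (ℚ._+ ℕ→ℚ r) n'-r≡Lq ⟩
  ℕ→ℚ L ℚ.* q ℚ.+ ℕ→ℚ r              ∎
  where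
  open ≡-Reasoning
  regroup : ∀ x s → x ≡ (x ℚ.- s) ℚ.+ s
  regroup = solve 2 (λ x s → x := (x :- s) :+ s) refl
  swap : ∀ a b c → a ℚ.* (b ℚ.* c) ≡ b ℚ.* (a ℚ.* c)
  swap = solve 3 (λ a b c → a :* (b :* c) := b :* (a :* c)) refl
  n'-r≡Lq : n' ℚ.- ℕ→ℚ r ≡ ℕ→ℚ L ℚ.* q
  n'-r≡Lq = ℕ→ℚ-*-cancelˡ 1≤M (trans iteration (trans (cong (ℕ→ℚ L ℚ.*_) n-s≡Mq) (swap (ℕ→ℚ L) (ℕ→ℚ M) q)))

module QuotientInduction
  (m l : ℕ) (f e : ℤ → ℕ)
  (k : ℤ → ℕ → ℚ) (d : ℤ → ℕ → ℕ)
  (k-step : (v : ℤ) (u : ℕ) →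
     (k v u ≡ ℕ→ℚ (m ^ f (v ℤ.+ + u)) ℚ.* k v (suc u) ℚ.+ ℕ→ℚ (d v u))
     × d v u < m ^ f (v ℤ.+ + u)
     × InZ⟨ m , l ⟩ (k v (suc u)))
  (j : ℤ → ℕ → ℚ) (b : ℤ → ℕ → ℕ)
  (j-step : (v : ℤ) (u : ℕ) →
     (j v u ≡ ℕ→ℚ (l ^ e (v ℤ.- + suc u)) ℚ.* j v (suc u) ℚ.+ ℕ→ℚ (b v u))
     × b v u < l ^ e (v ℤ.- + suc u)
     × InZ⟨ m , l ⟩ (j v (suc u)))
  where

  -- The division steps, with the index of the modulus given in any form i.
  k-step-at : ∀ {v u i} → v ℤ.+ + u ≡ i →
              (k v u ≡ ℕ→ℚ (m ^ f i) ℚ.* k v (suc u) ℚ.+ ℕ→ℚ (d v u)) × d v u < m ^ f i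
  k-step-at {v} {u} refl = proj₁ (k-step v u) , proj₁ (proj₂ (k-step v u))

  j-step-at : ∀ {v u i} → v ℤ.- + suc u ≡ i →
              (j v u ≡ ℕ→ℚ (l ^ e i) ℚ.* j v (suc u) ℚ.+ ℕ→ℚ (b v u)) × b v u < l ^ e i
  j-step-at {v} {u} refl = proj₁ (j-step v u) , proj₁ (proj₂ (j-step v u))

  k-primeDenom : ∀ v u → PrimeDenom⟨ m , l ⟩ (k v (suc u))
  k-primeDenom v u = inZ⇒primeDenom (proj₂ (proj₂ (k-step v u)))

  j-primeDenom : ∀ v u → PrimeDenom⟨ m , l ⟩ (j v (suc u))
  j-primeDenom v u = inZ⇒primeDenom (proj₂ (proj₂ (j-step v u)))

  Shifted : ℤ → ℕ → Set
  Shifted w u = Σ ℕ λ c → c < l ^ e w × k (w ℤ.+ + 1) u ≡ ℕ→ℚ (l ^ e w) ℚ.* k w (suc u) ℚ.+ ℕ→ℚ c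

  -- The carry lemma applied to the m-adic division of k_{w+1,u} and k_{w,u+1},
  -- both with modulus m^{f_{w+u+1}}.
  shift-step : ∀ w u → Shifted w u → Shifted w (suc u)
  shift-step w u (c , c<L , A≡LB+c)
    with k-step-at {w ℤ.+ + 1} {u} (ℤP.+-assoc w (+ 1) (+ u)) | k-step-at {w} {suc u} refl
  ... | A≡MX+d₁ , d₁<M | B≡MY+d₂ , d₂<M =
    carry-step (powers-of-m (f (w ℤ.+ + suc u))) (k-primeDenom (w ℤ.+ + 1) u) (k-primeDenom w (suc u))
               d₁<M d₂<M c<L A≡MX+d₁ B≡MY+d₂ A≡LB+c

  shifted : ∀ w → Shifted w 0 → ∀ u → Shifted w u
  shifted w s₀ zero    = s₀
  shifted w s₀ (suc u) = shift-step w u (shifted w s₀ u)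

  -- The modulus of the l-adic step of j_{w+x} at level x - 1 is l^{e_w}.
  add-sub : ∀ w x → (w ℤ.+ x) ℤ.- x ≡ w
  add-sub = ℤ-solve

  -- j_{w+u,u} = k_{w,u}: at u + 1 both sides are l^{e_w}-adic quotients of
  -- j_{w+u+1,u} = k_{w+1,u} (induction hypothesis at w + 1), so they agree by
  -- uniqueness of division.
  quotients-agree : (∀ w → j w 0 ≡ k w 0) → (∀ w → Shifted w 0) → ∀ u w → j (w ℤ.+ + u) u ≡ k w u
  quotients-agree j₀≡k₀ s₀ zero w = trans (cong (λ i → j i 0) (ℤP.+-identityʳ w)) (j₀≡k₀ w)
  quotients-agree j₀≡k₀ s₀ (suc u) w
    with j-step-at {w ℤ.+ + suc u} {u} (add-sub w (+ suc u)) | shifted w (s₀ w) u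
  ... | J≡LJ'+b , b<L | c , c<L , K≡LK'+c =
    proj₁ (digit-unique (powers-of-l (e w)) (j-primeDenom (w ℤ.+ + suc u) u) (k-primeDenom w u) b<L c<L
                        (trans (sym J≡LJ'+b) (trans induction-hypothesis K≡LK'+c)))
    where
    induction-hypothesis : j (w ℤ.+ + suc u) u ≡ k (w ℤ.+ + 1) u
    induction-hypothesis = trans (cong (λ i → j i u) (sym (ℤP.+-assoc w (+ 1) (+ u))))
                                 (quotients-agree j₀≡k₀ s₀ u (w ℤ.+ + 1))

corollary4p3 :
    (m l τ : ℕ) → 2 ≤ m → 2 ≤ l → Coprime m l → 1 ≤ τ →
    -- exponents f_v (τ-periodic, positive)
    (f : ℤ → ℕ) → Periodic τ f → ((v : ℤ) → 1 ≤ f v) →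
    -- the integers a_{v,i}, i ∈ {0,…,l-1} (τ-periodic in v)
    (a : ℤ → ℕ → ℤ) → ((v : ℤ) (i : ℕ) → a (v ℤ.+ + τ) i ≡ a v i) →
    ((v : ℤ) → a v 0 ≡ + 0) →
    ((v : ℤ) (i : ℕ) → 1 ≤ i → i < l →
       (a v i ≡ ℤ.- (+ (m ^ f v * i)) [mod l ])
       × ¬ (a v i ≡ + 0 [mod m ])
       × ¬ (a v i ≡ + 0 [mod l ])) →
    -- the admissible choices i_v, s_v, e_v, r_v (τ-periodic)
    (iv s e r : ℤ → ℕ) →
    Periodic τ iv → Periodic τ s → Periodic τ e → Periodic τ r →
    ((v : ℤ) →
       (1 ≤ iv v × iv v < l)
       × (1 ≤ s v × s v < m ^ f v × Coprime (s v) m)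
       × (1 ≤ e v × 1 ≤ r v)
       × (+ r v ≡ + iv v [mod l ])
       × (+ (l ^ e v * s v) ≡ + (m ^ f v * r v) ℤ.+ a v (iv v))
       × (ℤ.∣ a v (iv v) ∣ < m ^ f v ⊔ l ^ e v)) →
    -- the τ-periodic sequence of iterates n_v ∈ ℤ_{⟨m,l⟩}
    (n : ℤ → ℚ) → Periodic τ n →
    ((v : ℤ) →
       InZ⟨ m , l ⟩ (n v)
       × Cong⟨ m , l ⟩ (n v) (ℕ→ℚ (s v)) (m ^ f v)
       × (ℕ→ℚ (m ^ f v) ℚ.* (n (v ℤ.+ + 1) ℚ.- ℕ→ℚ (r v))
            ≡ ℕ→ℚ (l ^ e v) ℚ.* (n v ℚ.- ℕ→ℚ (s v)))) →
    -- the m-adic quotients k_{v,u} with digits d_{v,u}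
    (k : ℤ → ℕ → ℚ) (d : ℤ → ℕ → ℕ) →
    ((v : ℤ) → k v 0 ≡ n v) →
    ((v : ℤ) (u : ℕ) →
       (k v u ≡ ℕ→ℚ (m ^ f (v ℤ.+ + u)) ℚ.* k v (suc u) ℚ.+ ℕ→ℚ (d v u))
       × d v u < m ^ f (v ℤ.+ + u)
       × InZ⟨ m , l ⟩ (k v (suc u))) →
    -- the l-adic quotients j_{v,u} with digits b_{v,u}
    (j : ℤ → ℕ → ℚ) (b : ℤ → ℕ → ℕ) →
    ((v : ℤ) → j v 0 ≡ n v) →
    ((v : ℤ) (u : ℕ) →
       (j v u ≡ ℕ→ℚ (l ^ e (v ℤ.- + suc u)) ℚ.* j v (suc u) ℚ.+ ℕ→ℚ (b v u))
       × b v u < l ^ e (v ℤ.- + suc u)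
       × InZ⟨ m , l ⟩ (j v (suc u))) →
    -- conclusion
    (v : ℕ) → v < τ → (u : ℕ) → j (+ (v ℕ.+ u)) u ≡ k (+ v) u
corollary4p3 m l _ _ 2≤l _ _ f _ _ a _ _ a-conditions iv s e r _ _ _ _ admissible
             n _ iteration k d k₀ k-step j b j₀ j-step v _ u =
  quotients-agree (λ w → trans (j₀ w) (sym (k₀ w))) first-shift u (+ v)
  where
  open QuotientInduction m l f e k d k-step j b j-step
  instance
    l≢0 : ℕ.NonZero l
    l≢0 = ℕ.>-nonZero (ℕP.<-≤-trans (ℕ.s≤s ℕ.z≤n) 2≤l)
  first-shift : ∀ w → Shifted w 0
  first-shift w with admissible w | iteration w | k-step-at {w} {0} (ℤP.+-identityʳ w)
  ... | (1≤i , i<l) , (_ , s<M , _) , (1≤e , _) , _ , Ls≡Mr+a , ∣a∣<M⊔L | _ , n≡s , recurrence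
      | n≡Mk₁+d₀ , d₀<M =
    r w , r<L , trans (k₀ (w ℤ.+ + 1)) n[w+1]≡Lk₁+r

    where
    r<L : r w < l ^ e w
    r<L = remainder-bound (a w (iv w)) (ℕP.m^n>0 l (e w)) (divides-power 1≤e) s<M Ls≡Mr+a ∣a∣<M⊔L
                          (proj₂ (proj₂ (a-conditions w (iv w) 1≤i i<l)))
    n-s≡Mk₁ : n w ℚ.- ℕ→ℚ (s w) ≡ ℕ→ℚ (m ^ f w) ℚ.* k w 1
    n-s≡Mk₁ = first-digit {M = m ^ f w} {s = s w} {x = n w} (powers-of-m (f w)) s<M n≡s (trans (sym (k₀ w)) n≡Mk₁+d₀) d₀<M
                          (proj₂ (proj₂ (k-step w 0)))
    n[w+1]≡Lk₁+r : n (w ℤ.+ + 1) ≡ ℕ→ℚ (l ^ e w) ℚ.* k w 1 ℚ.+ ℕ→ℚ (r w)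
    n[w+1]≡Lk₁+r = successor-expansion {m ^ f w} {l ^ e w} {n w} {n (w ℤ.+ + 1)} {s w} {r w} {k w 1}
                                       (ℕP.≤-trans (ℕ.s≤s ℕ.z≤n) s<M) recurrence n-s≡Mk₁
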